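{- Let $t\in\mathbb{N}$, let $\mathcal{A}$ be a subfamily of a family $\mathcal{F}$, let $T$ be a set with $|A\cap T|\geq t$ for every $A\in\mathcal{A}$, and let $X$ be a $t$-element set with $\mathcal{A}\subseteq\mathcal{F}(X)$ and $X\not\subseteq T$. Then $|\mathcal{A}| \leq |T \setminus X|\, l(\mathcal{F},t+1)$.
   Context: All sets and families are finite. For a family $\mathcal{F}$ and a set $Y$, $\mathcal{F}(Y)=\{F\in\mathcal{F}:Y\subseteq F\}$, and $l(\mathcal{F},q)=\max\{|\mathcal{F}(Y)|: |Y|=q\}$. -}

module Defs where

open import Data.Nat using (ℕ; zero; suc; _⊔_)
open import Data.List using (List; []; _∷_; map; filter; length; foldr; _++_)
open import Data.Vec using (_∷_; [])
open import Data.Bool using (true; false)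
open import Data.Fin.Subset using (Subset; _⊆_; ∣_∣)
open import Data.Fin.Subset.Properties using (_⊆?_)
open import Data.Nat.Properties using (_≟_)
open import Relation.Unary using (Decidable)

-- Ground set: Fin n.  Sets: Subset n.  Families: List (Subset n)
-- (duplicate-freeness is imposed separately via Unique where needed).

allSubsets : (n : ℕ) → List (Subset n)
allSubsets zero = [] ∷ []
allSubsets (suc n) = map (true ∷_) (allSubsets n) ++ map (false ∷_) (allSubsets n)

famAt : ∀ {n} → List (Subset n) → Subset n → List (Subset n)
famAt F Y = filter (Y ⊆?_) F

-- l(F,q) = max { |F(Y)| : |Y| = q }  (max over the empty set is 0)
l : ∀ {n} → List (Subset n) → ℕ → ℕ
l {n} F q = foldr (λ Y m → length (famAt F Y) ⊔ m) 0
              (filter (λ Y → ∣ Y ∣ ≟ q) (allSubsets n))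

-- Every A ∈ 𝒜 contains X, and |A ∩ T| ≥ t = |X| > |X ∩ T| because X ⊈ T; hence A ∩ T ⊈ X,
-- i.e. A meets T ∖ X.  So 𝒜 is covered by the subfamilies 𝒜(X ∪ {y}), y ∈ T ∖ X, and each of
-- them lies in F(X ∪ {y}) with |X ∪ {y}| = t + 1, so has at most l(F, t + 1) members.
module Submission where

open import Defs
open import Data.Nat using (ℕ; suc; _≤_; _<_; _*_; _+_; _⊔_; z≤n; s≤s)
open import Data.Nat.Properties
  using (≤-trans; ≤-reflexive; ≤-<-trans; ≤⇒≯; +-mono-≤; +-suc; m≤m⊔n; m≤n⊔m; _≟_)
open import Data.List using (List; []; _∷_; _++_; length; filter; map; foldr)
open import Data.List.Properties using (length-++-sucʳ)
open import Data.List.Membership.Propositional using (_∈_)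
open import Data.List.Membership.Propositional.Properties
  using (∈-∃++; ∈-++⁺ˡ; ∈-++⁺ʳ; ∈-++⁻; ∈-map⁺; ∈-filter⁺; ∈-filter⁻)
open import Data.List.Relation.Unary.All as All using ()
open import Data.List.Relation.Unary.Any using (here; there)
open import Data.List.Relation.Unary.Unique.Propositional using (Unique; _∷_)
import Data.List.Relation.Unary.Unique.Propositional.Properties as Unique
import Data.List.Relation.Binary.Sublist.Propositional.Properties as Sublist
open import Data.Fin using (Fin; zero; suc)
open import Data.Fin.Subset
  using (Subset; inside; outside; _⊆_; _⊈_; _⊂_; _∩_; _∪_; _─_; ⁅_⁆; ∣_∣; Nonempty)
  renaming (_∈_ to _∈ₛ_; _∉_ to _∉ₛ_)
open import Data.Fin.Subset.Properties
  using (_∈?_; _⊆?_; nonempty?; p⊆q⇒∣p∣≤∣q∣; p⊂q⇒∣p∣<∣q∣; p∩q⊆p; x∈p∩q⁺; x∈p∩q⁻;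
         x∈p∪q⁻; x∈⁅y⁆⇒x≡y; ∪-identityʳ; x∈p∧x∉q⇒x∈p─q; p─q⊆p)
open import Data.Vec using ([]; _∷_; here; there)
open import Data.Product using (∃; _×_; _,_; proj₂)
open import Data.Sum using (inj₁; inj₂)
open import Data.Bool using (true; false)
open import Data.Empty using (⊥-elim)
open import Relation.Nullary using (yes; no; does)
open import Relation.Unary using (Pred; Decidable)
open import Relation.Unary.Properties using (∁?)
open import Relation.Binary.PropositionalEquality using (_≡_; refl; sym; trans; cong; subst)

private
  variable
    n : ℕ

x∈p─q⇒x∉q : ∀ (p q : Subset n) {x} → x ∈ₛ p ─ q → x ∉ₛ q
x∈p─q⇒x∉q (_ ∷ p) (outside ∷ q) here        ()
x∈p─q⇒x∉q (_ ∷ p) (_       ∷ q) (there x∈) (there x∈q) = x∈p─q⇒x∉q p q x∈ x∈q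

p⊈q⇒Nonempty[p─q] : {p q : Subset n} → p ⊈ q → Nonempty (p ─ q)
p⊈q⇒Nonempty[p─q] {p = p} {q} p⊈q with nonempty? (p ─ q)
... | yes ne = ne
... | no empty = ⊥-elim (p⊈q p⊆q)
  where
  p⊆q : p ⊆ q
  p⊆q {x} x∈p with x ∈? q
  ... | yes x∈q = x∈q
  ... | no x∉q  = ⊥-elim (empty (x , x∈p∧x∉q⇒x∈p─q x∈p x∉q))

p⊈q⇒∣p∩q∣<∣p∣ : {p q : Subset n} → p ⊈ q → ∣ p ∩ q ∣ < ∣ p ∣
p⊈q⇒∣p∩q∣<∣p∣ {p = p} {q} p⊈q with p⊈q⇒Nonempty[p─q] p⊈q
... | x , x∈p─q = p⊂q⇒∣p∣<∣q∣ p∩q⊂p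
  where
  p∩q⊂p : p ∩ q ⊂ p
  p∩q⊂p = p∩q⊆p p q , x , p─q⊆p p q x∈p─q
        , λ x∈p∩q → x∈p─q⇒x∉q p q x∈p─q (proj₂ (x∈p∩q⁻ p q x∈p∩q))

-- If p ∩ r ⊆ q then p ∩ r ⊆ q ∩ r, which is strictly smaller than q.
∣q∣≤∣p∩r∣∧q⊈r⇒Nonempty[p∩r─q] : {p q r : Subset n} →
  ∣ q ∣ ≤ ∣ p ∩ r ∣ → q ⊈ r → Nonempty (p ∩ r ─ q)
∣q∣≤∣p∩r∣∧q⊈r⇒Nonempty[p∩r─q] {p = p} {q} {r} ∣q∣≤∣p∩r∣ q⊈r =
  p⊈q⇒Nonempty[p─q] λ p∩r⊆q →
    ≤⇒≯ ∣q∣≤∣p∩r∣ (≤-<-trans (p⊆q⇒∣p∣≤∣q∣ (p∩r⊆q∩r p∩r⊆q)) (p⊈q⇒∣p∩q∣<∣p∣ q⊈r))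
  where
  p∩r⊆q∩r : p ∩ r ⊆ q → p ∩ r ⊆ q ∩ r
  p∩r⊆q∩r p∩r⊆q x∈p∩r = x∈p∩q⁺ (p∩r⊆q x∈p∩r , proj₂ (x∈p∩q⁻ p r x∈p∩r))

∣p∪⁅x⁆∣≡1+∣p∣ : ∀ (p : Subset n) {x} → x ∉ₛ p → ∣ p ∪ ⁅ x ⁆ ∣ ≡ suc ∣ p ∣
∣p∪⁅x⁆∣≡1+∣p∣ (inside  ∷ p) {zero}  x∉p = ⊥-elim (x∉p here)
∣p∪⁅x⁆∣≡1+∣p∣ (outside ∷ p) {zero}  x∉p = cong (λ q → suc ∣ q ∣) (∪-identityʳ p)
∣p∪⁅x⁆∣≡1+∣p∣ (inside  ∷ p) {suc x} x∉p = cong suc (∣p∪⁅x⁆∣≡1+∣p∣ p (λ x∈p → x∉p (there x∈p)))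
∣p∪⁅x⁆∣≡1+∣p∣ (outside ∷ p) {suc x} x∉p = ∣p∪⁅x⁆∣≡1+∣p∣ p (λ x∈p → x∉p (there x∈p))

Unique∧⊆⇒length≤ : ∀ {a} {A : Set a} {xs ys : List A} →
  Unique xs → (∀ {x} → x ∈ xs → x ∈ ys) → length xs ≤ length ys
Unique∧⊆⇒length≤ {xs = []}     _          _     = z≤n
Unique∧⊆⇒length≤ {xs = x ∷ xs} (x∉xs ∷ u) xs⊆ys with ∈-∃++ (xs⊆ys (here refl))
... | us , vs , refl =
  ≤-trans (s≤s (Unique∧⊆⇒length≤ u xs⊆us++vs)) (≤-reflexive (sym (length-++-sucʳ us x vs)))
  where
  xs⊆us++vs : ∀ {z} → z ∈ xs → z ∈ us ++ vs
  xs⊆us++vs z∈xs with ∈-++⁻ us (xs⊆ys (there z∈xs))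
  ... | inj₁ z∈us         = ∈-++⁺ˡ z∈us
  ... | inj₂ (here refl)  = ⊥-elim (All.lookup x∉xs z∈xs refl)
  ... | inj₂ (there z∈vs) = ∈-++⁺ʳ us z∈vs

length-filter+length-filter-∁ : ∀ {a p} {A : Set a} {P : Pred A p} (P? : Decidable P) xs →
  length (filter P? xs) + length (filter (∁? P?) xs) ≡ length xs
length-filter+length-filter-∁ P? []       = refl
length-filter+length-filter-∁ P? (x ∷ xs) with does (P? x)
... | true  = cong suc (length-filter+length-filter-∁ P? xs)
... | false = trans (+-suc _ _) (cong suc (length-filter+length-filter-∁ P? xs))

union-bound : ∀ {a p} {A : Set a} (P : Fin n → Pred A p) (P? : ∀ y → Decidable (P y))
  (S : Subset n) (xs : List A) (c : ℕ) →
  (∀ y → y ∈ₛ S → length (filter (P? y) xs) ≤ c) →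
  (∀ {x} → x ∈ xs → ∃ λ y → y ∈ₛ S × P y x) →
  length xs ≤ ∣ S ∣ * c
union-bound P P? [] [] c _ _ = z≤n
union-bound P P? [] (x ∷ xs) c _ cover with cover (here refl)
... | () , _
union-bound P P? (outside ∷ S) xs c bound cover =
  union-bound (λ y → P (suc y)) (λ y → P? (suc y)) S xs c
    (λ y y∈S → bound (suc y) (there y∈S)) cover′
  where
  cover′ : ∀ {x} → x ∈ xs → ∃ λ y → y ∈ₛ S × P (suc y) x
  cover′ x∈xs with cover x∈xs
  ... | suc y , there y∈S , Pyx = y , y∈S , Pyx
union-bound P P? (inside ∷ S) xs c bound cover =
  subst (_≤ c + ∣ S ∣ * c) (length-filter+length-filter-∁ (P? zero) xs)
    (+-mono-≤ (bound zero here)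
      (union-bound (λ y → P (suc y)) (λ y → P? (suc y)) S rest c bound′ cover′))
  where
  rest : List _
  rest = filter (∁? (P? zero)) xs
  bound′ : ∀ y → y ∈ₛ S → length (filter (P? (suc y)) rest) ≤ c
  bound′ y y∈S = ≤-trans
    (Sublist.length-mono-≤ (Sublist.filter⁺ (P? (suc y)) (P? (suc y)) (λ { refl Py → Py })
      (Sublist.filter-⊆ (∁? (P? zero)) xs)))
    (bound (suc y) (there y∈S))
  cover′ : ∀ {x} → x ∈ rest → ∃ λ y → y ∈ₛ S × P (suc y) x
  cover′ x∈rest with ∈-filter⁻ (∁? (P? zero)) x∈rest
  ... | x∈xs , ¬P₀x with cover x∈xs
  ...   | zero  , _          , P₀x = ⊥-elim (¬P₀x P₀x)
  ...   | suc y , there y∈S , Pyx = y , y∈S , Pyx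

∈-allSubsets : (p : Subset n) → p ∈ allSubsets n
∈-allSubsets []                    = here refl
∈-allSubsets {suc n} (inside  ∷ p) = ∈-++⁺ˡ (∈-map⁺ (inside ∷_) (∈-allSubsets p))
∈-allSubsets {suc n} (outside ∷ p) =
  ∈-++⁺ʳ (map (inside ∷_) (allSubsets n)) (∈-map⁺ (outside ∷_) (∈-allSubsets p))

≤-foldr-⊔ : ∀ {a} {A : Set a} (f : A → ℕ) {xs : List A} {x} →
  x ∈ xs → f x ≤ foldr (λ y m → f y ⊔ m) 0 xs
≤-foldr-⊔ f (here refl)  = m≤m⊔n _ _
≤-foldr-⊔ f (there x∈xs) = ≤-trans (≤-foldr-⊔ f x∈xs) (m≤n⊔m _ _)

length-famAt≤l : (F : List (Subset n)) (Y : Subset n) {q : ℕ} →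
  ∣ Y ∣ ≡ q → length (famAt F Y) ≤ l F q
length-famAt≤l F Y {q} ∣Y∣≡q =
  ≤-foldr-⊔ (λ Z → length (famAt F Z)) (∈-filter⁺ (λ Z → ∣ Z ∣ ≟ q) (∈-allSubsets Y) ∣Y∣≡q)

lemma3p2 : (n t : ℕ) (F 𝒜 : List (Subset n)) → Unique F → Unique 𝒜 →
    (∀ {A} → A ∈ 𝒜 → A ∈ F) →
    (T X : Subset n) →
    (∀ {A} → A ∈ 𝒜 → t ≤ ∣ A ∩ T ∣) →
    ∣ X ∣ ≡ t →
    (∀ {A} → A ∈ 𝒜 → A ∈ famAt F X) →
    X ⊈ T →
    length 𝒜 ≤ ∣ T ─ X ∣ * l F (suc t)
lemma3p2 n t F 𝒜 _ 𝒜-unique 𝒜⊆F T X large ∣X∣≡t 𝒜⊆F[X] X⊈T =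
  union-bound (λ y A → y ∈ₛ A) (λ y A → y ∈? A) (T ─ X) 𝒜 (l F (suc t))
    𝒜[X∪y]-small meets-T─X
  where
  meets-T─X : ∀ {A} → A ∈ 𝒜 → ∃ λ y → y ∈ₛ T ─ X × y ∈ₛ A
  meets-T─X {A} A∈𝒜
    with ∣q∣≤∣p∩r∣∧q⊈r⇒Nonempty[p∩r─q] (subst (_≤ ∣ A ∩ T ∣) (sym ∣X∣≡t) (large A∈𝒜)) X⊈T
  ... | y , y∈A∩T─X with x∈p∩q⁻ A T (p─q⊆p (A ∩ T) X y∈A∩T─X)
  ...   | y∈A , y∈T = y , x∈p∧x∉q⇒x∈p─q y∈T (x∈p─q⇒x∉q (A ∩ T) X y∈A∩T─X) , y∈A

  𝒜[X∪y]⊆F[X∪y] : ∀ {y A} → A ∈ filter (y ∈?_) 𝒜 → A ∈ famAt F (X ∪ ⁅ y ⁆)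
  𝒜[X∪y]⊆F[X∪y] {y} {A} A∈𝒜[y] with ∈-filter⁻ (y ∈?_) A∈𝒜[y]
  ... | A∈𝒜 , y∈A = ∈-filter⁺ ((X ∪ ⁅ y ⁆) ⊆?_) (𝒜⊆F A∈𝒜) X∪y⊆A
    where
    X∪y⊆A : X ∪ ⁅ y ⁆ ⊆ A
    X∪y⊆A z∈X∪y with x∈p∪q⁻ X ⁅ y ⁆ z∈X∪y
    ... | inj₁ z∈X = proj₂ (∈-filter⁻ (X ⊆?_) {xs = F} (𝒜⊆F[X] A∈𝒜)) z∈X
    ... | inj₂ z∈y rewrite x∈⁅y⁆⇒x≡y y z∈y = y∈A

  𝒜[X∪y]-small : ∀ y → y ∈ₛ T ─ X → length (filter (y ∈?_) 𝒜) ≤ l F (suc t)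
  𝒜[X∪y]-small y y∈T─X = ≤-trans
    (Unique∧⊆⇒length≤ (Unique.filter⁺ (y ∈?_) 𝒜-unique) 𝒜[X∪y]⊆F[X∪y])
    (length-famAt≤l F (X ∪ ⁅ y ⁆) (trans (∣p∪⁅x⁆∣≡1+∣p∣ X (x∈p─q⇒x∉q T X y∈T─X)) (cong suc ∣X∣≡t)))
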